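{- Let $p$ be an odd prime and let $n,s$ be positive integers such that $2n/s \geq 3$ is an odd integer; put $q = p^n$, $d = p^s$, and let $\mathbb{F}_q \subset \mathbb{F}_{q^2}$ be the subfield of order $q$. Fix $\mu \in \mathbb{F}_{q^2} \setminus \mathbb{F}_q$ such that $\mu^d = u_1 + u_2\mu$ with $u_1,u_2 \in \mathbb{F}_q$ and $u_2$ a $(d-1)$-th power in $\mathbb{F}_{q^2}$. Let \[ J = \{(a^d + a, x_1 + x_2\mu) : a, x_1 \in \mathbb{F}_q,\ x_2 \in \mathbb{F}_q \setminus\{0\}\}, \qquad K = \bigcup_{\beta \in \mathbb{F}_q} \phi_{(\beta\mu)^d + \beta\mu}(J), \] where for $k = \alpha^d + \alpha$ the map $\phi_k$ is $\phi_k((a^d + a, x)) = (a^d + a + k,\ x + a^d\alpha + a\alpha^d + \alpha^{d+1})$. Then the subgraph $\mathcal{A}_{q^2,d}[K]$ of $\mathcal{A}_{q^2,d}$ induced by $K$ satisfies $\chi(\mathcal{A}_{q^2,d}[K]) \leq 2q$.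
   Context: The map $x \mapsto x^d + x$ is a bijection of $\mathbb{F}_{q^2}$, so every element is uniquely of the form $a^d+a$. $\mathcal{A}_{q^2,d}$ is the graph with vertex set $\mathbb{F}_{q^2} \times \mathbb{F}_{q^2}$ in which distinct vertices $(a^d + a, x)$ and $(b^d + b, y)$ are adjacent iff $a^d b + a b^d = x + y$. $\chi$ denotes chromatic number. -}

module Defs where

open import Level using (0ℓ)
open import Data.Nat as ℕ using (ℕ; zero; suc)
open import Data.Fin using (Fin)
open import Data.Product using (Σ; ∃; _×_; _,_)
open import Relation.Binary.PropositionalEquality using (_≡_)
open import Relation.Nullary using (¬_)
open import Function.Bundles using (_↔_)
open import Algebra.Structures using (IsCommutativeRing)

record FiniteField (card : ℕ) : Set₁ where
  infixl 6 _+_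
  infixl 7 _*_
  field
    Carrier : Set
    _+_ _*_ : Carrier → Carrier → Carrier
    -_      : Carrier → Carrier
    0# 1#   : Carrier
    isCommutativeRing : IsCommutativeRing _≡_ _+_ _*_ -_ 0# 1#
    0≢1     : ¬ (0# ≡ 1#)
    inverse : ∀ x → ¬ (x ≡ 0#) → Σ Carrier λ y → x * y ≡ 1#
    enumeration : Carrier ↔ Fin card

  _^_ : Carrier → ℕ → Carrier
  x ^ zero  = 1#
  x ^ suc k = x * (x ^ k)

module Construction {card : ℕ} (F : FiniteField card) (q d : ℕ) where
  open FiniteField F

  InFq : Carrier → Set
  InFq x = x ^ q ≡ x

  Vertex : Set
  Vertex = Carrier × Carrier

  Adj : Vertex → Vertex → Set
  Adj (u , x) (v , y) =
    ¬ ((u , x) ≡ (v , y)) ×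
    ∃ λ a → ∃ λ b → u ≡ a ^ d + a × v ≡ b ^ d + b × (a ^ d) * b + a * (b ^ d) ≡ x + y

  InJ : Carrier → Vertex → Set
  InJ μ w = ∃ λ a → ∃ λ x₁ → ∃ λ x₂ →
    InFq a × InFq x₁ × InFq x₂ × ¬ (x₂ ≡ 0#) × w ≡ (a ^ d + a , x₁ + x₂ * μ)

  -- φ_k for k = α^d + α, applied to (a^d + a, x)
  φ : Carrier → Carrier → Carrier → Vertex
  φ α a x = (a ^ d + a + (α ^ d + α) , x + (a ^ d) * α + a * (α ^ d) + α ^ (suc d))

  InK : Carrier → Vertex → Set
  InK μ w = ∃ λ β → ∃ λ a → ∃ λ x₁ → ∃ λ x₂ →
    InFq β × InFq a × InFq x₁ × InFq x₂ × ¬ (x₂ ≡ 0#) ×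
    w ≡ φ (β * μ) a (x₁ + x₂ * μ)

  ChromaticAtMost : Carrier → ℕ → Set
  ChromaticAtMost μ m = Σ (Vertex → Fin m) λ c →
    ∀ v w → InK μ v → InK μ w → Adj v w → ¬ (c v ≡ c w)

module Submission where

-- Every vertex of K has the form φ_{βμ}(a, x₁ + x₂μ) with β, a, x₁ ∈ F_q and
-- x₂ ∈ F_q \ {0}.  Colour it by the pair (β, sign x₂), where the sign separates z from -z
-- (possible since the characteristic p is odd); this uses 2q colours.  The colouring is proper:
-- all maps φ_k are translations of the graph, so two adjacent vertices with the same β come from
-- adjacent vertices (a^d+a, x₁+x₂μ), (a'^d+a', x₁'+x₂'μ), i.e. a^d a' + a a'^d = (x₁+x₁') + (x₂+x₂')μ.
-- The left side lies in F_q and μ ∉ F_q, so x₂' = -x₂, which has the opposite sign.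

open import Defs
open import Level using (0ℓ)
open import Algebra.Bundles using (CommutativeRing)
import Algebra.Properties.Ring
import Algebra.Properties.CommutativeMonoid.Sum
import Algebra.Properties.Semiring.Mult
import Algebra.Properties.Semiring.Exp
import Algebra.Properties.CommutativeSemiring.Binomial
import Algebra.Solver.Ring.NaturalCoefficients.Default
open import Data.Nat as ℕ using (ℕ; zero; suc; _≤_; _<_; z≤n; s≤s; _!)
import Data.Nat.Properties as ℕP
open import Data.Nat.Combinatorics using (_C_; nCk≡n!/k![n-k]!; k![n∸k]!∣n!; nCn≡1)
open import Data.Nat.Divisibility using (_∣_; divides; ∣1⇒≡1; ∣⇒≤; m∣m*n)
open import Data.Nat.DivMod using (m/n*n≡m)
open import Data.Nat.Primality using (Prime; euclidsLemma; ¬prime[1]; prime⇒nonZero)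
open import Data.Fin as Fin using (Fin)
import Data.Fin.Properties as FinP
open import Data.Fin.Permutation using (Permutation)
open import Data.Bool.Base using (Bool; true; false)
open import Data.List.Base using (List; _∷_; filter; length; lookup; allFin)
open import Data.List.Membership.Propositional.Properties using (∈-filter⁺; ∈-filter⁻; ∈-allFin; ∈-lookup)
import Data.List.Membership.Setoid.Properties as Membershipₛ
open import Data.List.Relation.Unary.Any using (index)
import Data.List.Relation.Unary.All as All
open import Data.List.Relation.Unary.Unique.Propositional using (Unique)
open import Data.List.Relation.Unary.AllPairs using (_∷_)
import Data.List.Relation.Unary.Unique.Propositional.Properties as Unique
open import Data.Product using (∃; _×_; _,_; proj₁; proj₂)
import Data.Product.Properties as ×P
open import Data.Sum using (inj₁; inj₂)
open import Data.Empty using (⊥-elim)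
open import Function.Base using (_∘_)
open import Function.Bundles using (Inverse; _↔_; mk↔ₛ′)
open import Function.Construct.Composition using (_↔-∘_)
open import Function.Construct.Symmetry using (↔-sym)
open import Relation.Binary.PropositionalEquality
open import Relation.Binary.Definitions using (DecidableEquality)
open import Relation.Nullary using (¬_; Dec; yes; no; contradiction)
open import Relation.Nullary.Decidable using (does; map′; _×-dec_; ¬?)
open import Relation.Unary using (Decidable)
open ≡-Reasoning

prime∤factorial : ∀ {p} → Prime p → ∀ m → m < p → ¬ (p ∣ m !)
prime∤factorial p-prime zero m<p p∣1 = ¬prime[1] (subst Prime (∣1⇒≡1 p∣1) p-prime)
prime∤factorial p-prime (suc m) m<p p∣m! with euclidsLemma (suc m) (m !) p-prime p∣m!
... | inj₁ p∣1+m = ℕP.<⇒≱ m<p (∣⇒≤ p∣1+m)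
... | inj₂ p∣m!′ = prime∤factorial p-prime m (ℕP.<-trans (ℕP.n<1+n m) m<p) p∣m!′

-- A prime p divides the binomial coefficients p C k with 0 < k < p, since
-- (p C k)·k!·(p-k)! = p! while p divides neither k! nor (p-k)!.
prime∣binomial : ∀ {p k} → Prime p → 0 < k → k < p → p ∣ p C k
prime∣binomial {suc r} {k} p-prime 0<k k<p
  with euclidsLemma (suc r C k) (k ! ℕ.* (suc r ℕ.∸ k) !) p-prime p∣product
  where
  product≡p! : (suc r C k) ℕ.* (k ! ℕ.* (suc r ℕ.∸ k) !) ≡ suc r !
  product≡p! = trans (cong (ℕ._* (k ! ℕ.* (suc r ℕ.∸ k) !)) (nCk≡n!/k![n-k]! (ℕP.<⇒≤ k<p)))
                     (m/n*n≡m {{k ℕP.!* (suc r ℕ.∸ k) !≢0}} (k![n∸k]!∣n! (ℕP.<⇒≤ k<p)))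
  p∣product : suc r ∣ (suc r C k) ℕ.* (k ! ℕ.* (suc r ℕ.∸ k) !)
  p∣product = subst (suc r ∣_) (sym product≡p!) (m∣m*n (r !))
... | inj₁ p∣C = p∣C
... | inj₂ p∣factorials with euclidsLemma (k !) ((suc r ℕ.∸ k) !) p-prime p∣factorials
...   | inj₁ p∣k! = contradiction p∣k! (prime∤factorial p-prime k k<p)
...   | inj₂ p∣[p-k]! =
  contradiction p∣[p-k]! (prime∤factorial p-prime (suc r ℕ.∸ k) (ℕP.∸-monoʳ-< 0<k (ℕP.<⇒≤ k<p)))

<-symmetric⇒≡ : ∀ {i j} (i<?j : Dec (i < j)) (j<?i : Dec (j < i)) → does i<?j ≡ does j<?i → i ≡ j
<-symmetric⇒≡ (yes i<j) (yes j<i) _ = ⊥-elim (ℕP.<-asym i<j j<i)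
<-symmetric⇒≡ (no i≮j)  (no j≮i)  _ = ℕP.≤-antisym (ℕP.≮⇒≥ j≮i) (ℕP.≮⇒≥ i≮j)
<-symmetric⇒≡ (yes _)   (no _)    ()
<-symmetric⇒≡ (no _)    (yes _)   ()

bit : Bool → Fin 2
bit false = Fin.zero
bit true  = Fin.suc Fin.zero

bit-injective : ∀ a b → bit a ≡ bit b → a ≡ b
bit-injective false false _ = refl
bit-injective true  true  _ = refl

lookup-injective : ∀ {A : Set} (xs : List A) → Unique xs → ∀ i j → lookup xs i ≡ lookup xs j → i ≡ j
lookup-injective (x ∷ xs) _ Fin.zero Fin.zero _ = refl
lookup-injective (x ∷ xs) (x∉xs ∷ u) Fin.zero (Fin.suc j) e = ⊥-elim (All.lookup x∉xs (∈-lookup j) e)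
lookup-injective (x ∷ xs) (x∉xs ∷ u) (Fin.suc i) Fin.zero e = ⊥-elim (All.lookup x∉xs (∈-lookup i) (sym e))
lookup-injective (x ∷ xs) (x∉xs ∷ u) (Fin.suc i) (Fin.suc j) e = cong Fin.suc (lookup-injective xs u i j e)

module Ranking {n : ℕ} {P : Fin n → Set} (P? : Decidable P) where
  members : List (Fin n)
  members = filter P? (allFin n)

  size : ℕ
  size = length members

  rank : ∀ i → P i → Fin size
  rank i pi = index (∈-filter⁺ P? (∈-allFin i) pi)

  rank-injective : ∀ {i j} (pi : P i) (pj : P j) → rank i pi ≡ rank j pj → i ≡ j
  rank-injective pi pj = Membershipₛ.index-injective (setoid (Fin n)) _ _

  member : Fin size → Fin n
  member = lookup members

  member-∈ : ∀ k → P (member k)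
  member-∈ k = proj₂ (∈-filter⁻ P? {xs = allFin n} (∈-lookup k))

  member-injective : ∀ k l → member k ≡ member l → k ≡ l
  member-injective = lookup-injective members (Unique.filter⁺ P? (Unique.allFin⁺ n))

module FiniteFieldTheory {N : ℕ} (F : FiniteField N) where
  open FiniteField F
  open Inverse enumeration using (to; from; strictlyInverseˡ; strictlyInverseʳ)

  ring : CommutativeRing 0ℓ 0ℓ
  ring = record { isCommutativeRing = isCommutativeRing }

  private
    module R = CommutativeRing ring
    module ∑ = Algebra.Properties.CommutativeMonoid.Sum R.+-commutativeMonoid
    module ∏ = Algebra.Properties.CommutativeMonoid.Sum R.*-commutativeMonoid
    module Exp = Algebra.Properties.Semiring.Exp R.semiring
    module Binomial = Algebra.Properties.CommutativeSemiring.Binomial R.commutativeSemiring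
  open Algebra.Properties.Ring R.ring
    using (-‿involutive; +-inverseʳ-unique; +-identityʳ-unique; x∙y⁻¹≈ε⇒x≈y; -‿distribˡ-*; +-cancelʳ;
           -‿anti-homo-+)
  open Algebra.Properties.Semiring.Mult R.semiring public using () renaming (_×_ to _·_)
  open Algebra.Properties.Semiring.Mult R.semiring using (×-assocˡ; ×-assoc-*; ×1-homo-*)
  open Algebra.Solver.Ring.NaturalCoefficients.Default R.commutativeSemiring
    using (solve; _:=_; _:+_; _:*_)

  to-injective : ∀ {x y} → to x ≡ to y → x ≡ y
  to-injective {x} {y} e = trans (sym (strictlyInverseʳ x)) (trans (cong from e) (strictlyInverseʳ y))

  _≟_ : DecidableEquality Carrier
  x ≟ y = map′ to-injective (cong to) (to x Fin.≟ to y)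

  ∃? : {P : Carrier → Set} → Decidable P → Dec (∃ P)
  ∃? {P} P? = map′ (λ (i , pi) → from i , pi)
                   (λ (z , pz) → to z , subst P (sym (strictlyInverseʳ z)) pz)
                   (FinP.any? (P? ∘ from))

  inverse-cancel : ∀ {x x⁻¹} → x * x⁻¹ ≡ 1# → ∀ y → x⁻¹ * (x * y) ≡ y
  inverse-cancel {x} {x⁻¹} xx⁻¹≡1 y = begin
    x⁻¹ * (x * y)  ≡⟨ solve 3 (λ x x⁻¹ y → x⁻¹ :* (x :* y) := (x :* x⁻¹) :* y) refl x x⁻¹ y ⟩
    (x * x⁻¹) * y  ≡⟨ cong (_* y) xx⁻¹≡1 ⟩
    1# * y         ≡⟨ R.*-identityˡ y ⟩
    y              ∎

  *-nonzero : ∀ {x y} → ¬ x ≡ 0# → ¬ y ≡ 0# → ¬ x * y ≡ 0#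
  *-nonzero {x} {y} x≢0 y≢0 xy≡0 = y≢0 (begin
    y              ≡⟨ sym (inverse-cancel (proj₂ (inverse x x≢0)) y) ⟩
    x⁻¹ * (x * y)  ≡⟨ cong (x⁻¹ *_) xy≡0 ⟩
    x⁻¹ * 0#       ≡⟨ R.zeroʳ x⁻¹ ⟩
    0#             ∎)
    where
    x⁻¹ : Carrier
    x⁻¹ = proj₁ (inverse x x≢0)

  *-cancelʳ : ∀ {a} b c → ¬ a ≡ 0# → b * a ≡ c * a → b ≡ c
  *-cancelʳ {a} b c a≢0 ba≡ca = begin
    b              ≡⟨ sym (inverse-cancel aa⁻¹≡1 b) ⟩
    a⁻¹ * (a * b)  ≡⟨ cong (a⁻¹ *_) (trans (R.*-comm a b) (trans ba≡ca (R.*-comm c a))) ⟩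
    a⁻¹ * (a * c)  ≡⟨ inverse-cancel aa⁻¹≡1 c ⟩
    c              ∎
    where
    a⁻¹ : Carrier
    a⁻¹ = proj₁ (inverse a a≢0)
    aa⁻¹≡1 : a * a⁻¹ ≡ 1#
    aa⁻¹≡1 = proj₂ (inverse a a≢0)

  ≡-⇒≡0 : ¬ 1# + 1# ≡ 0# → ∀ {z} → z ≡ - z → z ≡ 0#
  ≡-⇒≡0 two≢0 {z} z≡-z with z ≟ 0#
  ... | yes z≡0 = z≡0
  ... | no z≢0 = ⊥-elim (*-nonzero two≢0 z≢0 (begin
    (1# + 1#) * z    ≡⟨ R.distribʳ z 1# 1# ⟩
    1# * z + 1# * z  ≡⟨ cong₂ _+_ (R.*-identityˡ z) (R.*-identityˡ z) ⟩
    z + z            ≡⟨ cong (z +_) z≡-z ⟩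
    z + - z          ≡⟨ R.-‿inverseʳ z ⟩
    0#               ∎))

  ^-+ : ∀ x m n → x ^ (m ℕ.+ n) ≡ x ^ m * x ^ n
  ^-+ x zero    n = sym (R.*-identityˡ _)
  ^-+ x (suc m) n = trans (cong (x *_) (^-+ x m n)) (sym (R.*-assoc x _ _))

  ^-* : ∀ x m n → x ^ (m ℕ.* n) ≡ (x ^ n) ^ m
  ^-* x zero    n = refl
  ^-* x (suc m) n = trans (^-+ x n (m ℕ.* n)) (cong (x ^ n *_) (^-* x m n))

  *-^ : ∀ x y n → (x * y) ^ n ≡ x ^ n * y ^ n
  *-^ x y zero    = sym (R.*-identityˡ 1#)
  *-^ x y (suc n) = begin
    (x * y) * (x * y) ^ n      ≡⟨ cong ((x * y) *_) (*-^ x y n) ⟩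
    (x * y) * (x ^ n * y ^ n)  ≡⟨ solve 4 (λ x y a b → (x :* y) :* (a :* b) := (x :* a) :* (y :* b))
                                        refl x y (x ^ n) (y ^ n) ⟩
    (x * x ^ n) * (y * y ^ n)  ∎

  1^ : ∀ n → 1# ^ n ≡ 1#
  1^ zero    = refl
  1^ (suc n) = trans (R.*-identityˡ _) (1^ n)

  ^-nonzero : ∀ {x} n → ¬ x ≡ 0# → ¬ x ^ n ≡ 0#
  ^-nonzero zero    x≢0 1≡0 = 0≢1 (sym 1≡0)
  ^-nonzero (suc n) x≢0     = *-nonzero x≢0 (^-nonzero n x≢0)

  0^ : ∀ {n} → 0 < n → 0# ^ n ≡ 0#
  0^ {suc n} _ = R.zeroˡ _

  ^≡0⇒≡0 : ∀ {x} n → x ^ n ≡ 0# → x ≡ 0#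
  ^≡0⇒≡0 {x} n xⁿ≡0 with x ≟ 0#
  ... | yes x≡0 = x≡0
  ... | no x≢0  = contradiction xⁿ≡0 (^-nonzero n x≢0)

  ^≡Exp^ : ∀ x n → x ^ n ≡ x Exp.^ n
  ^≡Exp^ x zero    = refl
  ^≡Exp^ x (suc n) = cong (x *_) (^≡Exp^ x n)

  reindexing : Carrier ↔ Carrier → Permutation N N
  reindexing π = enumeration ↔-∘ (π ↔-∘ ↔-sym enumeration)

  ∑-reindex : (π : Carrier ↔ Carrier) (t : Carrier → Carrier) →
              ∑.sum (t ∘ from) ≡ ∑.sum (t ∘ Inverse.to π ∘ from)
  ∑-reindex π t = trans (∑.sum-permute (t ∘ from) (reindexing π))
                        (∑.sum-cong-≗ {N} (λ i → cong t (strictlyInverseʳ (Inverse.to π (from i)))))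

  ∏-reindex : (π : Carrier ↔ Carrier) (t : Carrier → Carrier) →
              ∏.sum (t ∘ from) ≡ ∏.sum (t ∘ Inverse.to π ∘ from)
  ∏-reindex π t = trans (∏.sum-permute (t ∘ from) (reindexing π))
                        (∏.sum-cong-≗ {N} (λ i → cong t (strictlyInverseʳ (Inverse.to π (from i)))))

  -- N · 1 = 0: translating every element by 1 leaves ∑ z unchanged but adds N · 1.
  N·1≡0 : N · 1# ≡ 0#
  N·1≡0 = +-identityʳ-unique (∑.sum from) (N · 1#) (sym (begin
    ∑.sum from                          ≡⟨ ∑-reindex (mk↔ₛ′ (_+ 1#) (_+ - 1#) cancel cancel′) (λ z → z) ⟩
    ∑.sum (λ i → from i + 1#)           ≡⟨ ∑.∑-distrib-+ from (λ _ → 1#) ⟩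
    ∑.sum from + ∑.sum {N} (λ _ → 1#)   ≡⟨ cong (∑.sum from +_) (∑.sum-replicate N) ⟩
    ∑.sum from + N · 1#                 ∎))
    where
    cancel : ∀ z → (z + - 1#) + 1# ≡ z
    cancel z = trans (R.+-assoc z (- 1#) 1#) (trans (cong (z +_) (R.-‿inverseˡ 1#)) (R.+-identityʳ z))
    cancel′ : ∀ z → (z + 1#) + - 1# ≡ z
    cancel′ z = trans (R.+-assoc z 1# (- 1#)) (trans (cong (z +_) (R.-‿inverseʳ 1#)) (R.+-identityʳ z))

  ∏-nonzero : ∀ n (t : Fin n → Carrier) → (∀ i → ¬ t i ≡ 0#) → ¬ ∏.sum t ≡ 0#
  ∏-nonzero zero    t t≢0 1≡0 = 0≢1 (sym 1≡0)
  ∏-nonzero (suc n) t t≢0     = *-nonzero (t≢0 Fin.zero) (∏-nonzero n (t ∘ Fin.suc) (t≢0 ∘ Fin.suc))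

  ∏-constant : ∀ x n → ∏.sum {n} (λ _ → x) ≡ x ^ n
  ∏-constant x zero    = refl
  ∏-constant x (suc n) = cong (x *_) (∏-constant x n)

  ∏-all-but-one : ∀ x n (t : Fin n → Carrier) i →
                  t i ≡ 1# → (∀ j → ¬ j ≡ i → t j ≡ x) → ∏.sum t * x ≡ x ^ n
  ∏-all-but-one x (suc n) t i tᵢ≡1 others = begin
    ∏.sum t * x                                   ≡⟨ cong (_* x) (∏.sum-remove {i = i} t) ⟩
    (t i * ∏.sum (t ∘ Fin.punchIn i)) * x         ≡⟨ cong (λ a → (a * ∏.sum (t ∘ Fin.punchIn i)) * x) tᵢ≡1 ⟩
    (1# * ∏.sum (t ∘ Fin.punchIn i)) * x          ≡⟨ cong (_* x) (R.*-identityˡ _) ⟩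
    ∏.sum (t ∘ Fin.punchIn i) * x                 ≡⟨ cong (_* x) (∏.sum-cong-≗ {n} rest≡x) ⟩
    ∏.sum {n} (λ _ → x) * x                       ≡⟨ cong (_* x) (∏-constant x n) ⟩
    x ^ n * x                                     ≡⟨ R.*-comm _ x ⟩
    x ^ suc n                                     ∎
    where
    rest≡x : ∀ j → t (Fin.punchIn i j) ≡ x
    rest≡x j = others (Fin.punchIn i j) (FinP.punchInᵢ≢i i j)

  ifZero : Carrier → Carrier → Carrier → Carrier
  ifZero z a b with z ≟ 0#
  ... | yes _ = a
  ... | no _  = b

  ifZero-yes : ∀ {z} a b → z ≡ 0# → ifZero z a b ≡ a
  ifZero-yes {z} a b z≡0 with z ≟ 0#
  ... | yes _   = refl
  ... | no z≢0  = contradiction z≡0 z≢0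

  ifZero-no : ∀ {z} a b → ¬ z ≡ 0# → ifZero z a b ≡ b
  ifZero-no {z} a b z≢0 with z ≟ 0#
  ... | yes z≡0 = contradiction z≡0 z≢0
  ... | no _    = refl

  -- Fermat's little theorem for x ≠ 0.  With unit z = (z, or 1 if z = 0), multiplication by x
  -- permutes the field and unit (x z) = scale z · unit z, where scale z = (x, or 1 if z = 0).
  -- Hence ∏ scale = 1, while (∏ scale) · x = x^N.
  module Fermat (x : Carrier) (x≢0 : ¬ x ≡ 0#) where
    x⁻¹ : Carrier
    x⁻¹ = proj₁ (inverse x x≢0)

    scaling : Carrier ↔ Carrier
    scaling = mk↔ₛ′ (x *_) (x⁻¹ *_) (inverse-cancel (trans (R.*-comm x⁻¹ x) (proj₂ (inverse x x≢0))))
                                     (inverse-cancel (proj₂ (inverse x x≢0)))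

    unit scale : Carrier → Carrier
    unit z  = ifZero z 1# z
    scale z = ifZero z 1# x

    unit-nonzero : ∀ z → ¬ unit z ≡ 0#
    unit-nonzero z with z ≟ 0#
    ... | yes _   = λ 1≡0 → 0≢1 (sym 1≡0)
    ... | no z≢0  = z≢0

    unit-scaling : ∀ z → unit (x * z) ≡ scale z * unit z
    unit-scaling z with z ≟ 0#
    ... | yes z≡0 = trans (ifZero-yes 1# (x * z) (trans (cong (x *_) z≡0) (R.zeroʳ x))) (sym (R.*-identityˡ 1#))
    ... | no z≢0  = ifZero-no 1# (x * z) (*-nonzero x≢0 z≢0)

    ∏unit≡∏scale*∏unit : ∏.sum (unit ∘ from) ≡ ∏.sum (scale ∘ from) * ∏.sum (unit ∘ from)
    ∏unit≡∏scale*∏unit = begin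
      ∏.sum (unit ∘ from)                           ≡⟨ ∏-reindex scaling unit ⟩
      ∏.sum (λ i → unit (x * from i))               ≡⟨ ∏.sum-cong-≗ {N} (unit-scaling ∘ from) ⟩
      ∏.sum (λ i → scale (from i) * unit (from i))  ≡⟨ ∏.∑-distrib-+ (scale ∘ from) (unit ∘ from) ⟩
      ∏.sum (scale ∘ from) * ∏.sum (unit ∘ from)    ∎

    ∏scale≡1 : ∏.sum (scale ∘ from) ≡ 1#
    ∏scale≡1 = *-cancelʳ _ 1# (∏-nonzero N (unit ∘ from) (unit-nonzero ∘ from))
                             (trans (sym ∏unit≡∏scale*∏unit) (sym (R.*-identityˡ _)))

    x^N≡x : x ^ N ≡ x
    x^N≡x = begin
      x ^ N                     ≡⟨ sym (∏-all-but-one x N (scale ∘ from) (to 0#) scale-0 scale-nonzero) ⟩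
      ∏.sum (scale ∘ from) * x  ≡⟨ cong (_* x) ∏scale≡1 ⟩
      1# * x                    ≡⟨ R.*-identityˡ x ⟩
      x                         ∎
      where
      scale-0 : scale (from (to 0#)) ≡ 1#
      scale-0 = ifZero-yes 1# x (strictlyInverseʳ 0#)
      scale-nonzero : ∀ j → ¬ j ≡ to 0# → scale (from j) ≡ x
      scale-nonzero j j≢0 = ifZero-no 1# x (λ e → j≢0 (trans (sym (strictlyInverseˡ j)) (cong to e)))

  fermat : ∀ x → x ^ N ≡ x
  fermat x with x ≟ 0#
  ... | no x≢0 = Fermat.x^N≡x x x≢0
  ... | yes refl = 0^ (ℕP.≤-<-trans z≤n (FinP.toℕ<n (to 0#)))

  ·1-^ : ∀ p k → (p ℕ.^ k) · 1# ≡ (p · 1#) ^ k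
  ·1-^ p zero    = R.+-identityʳ 1#
  ·1-^ p (suc k) = trans (×1-homo-* p (p ℕ.^ k)) (cong ((p · 1#) *_) (·1-^ p k))

  characteristic : ∀ p k → N ≡ p ℕ.^ k → p · 1# ≡ 0#
  characteristic p k N≡p^k = ^≡0⇒≡0 k (begin
    (p · 1#) ^ k        ≡⟨ sym (·1-^ p k) ⟩
    (p ℕ.^ k) · 1#      ≡⟨ cong (_· 1#) (sym N≡p^k) ⟩
    N · 1#              ≡⟨ N·1≡0 ⟩
    0#                  ∎)

  -- In odd characteristic p = 1 + 2t we have 2 ≠ 0, because p · 1 = 1 + (2 · 1)(t · 1).
  two≢0 : ∀ {p t} → p · 1# ≡ 0# → p ≡ 1 ℕ.+ 2 ℕ.* t → ¬ 1# + 1# ≡ 0#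
  two≢0 {p} {t} p·1≡0 p≡1+2t two≡0 = 0≢1 (sym (begin
    1#                    ≡⟨ sym (R.+-identityʳ 1#) ⟩
    1# + 0#               ≡⟨ cong (1# +_) (sym 2t·1≡0) ⟩
    1# + (2 ℕ.* t) · 1#   ≡⟨ cong (_· 1#) (sym p≡1+2t) ⟩
    p · 1#                ≡⟨ p·1≡0 ⟩
    0#                    ∎))
    where
    2t·1≡0 : (2 ℕ.* t) · 1# ≡ 0#
    2t·1≡0 = begin
      (2 ℕ.* t) · 1#               ≡⟨ ×1-homo-* 2 t ⟩
      (1# + (1# + 0#)) * (t · 1#)  ≡⟨ cong (λ a → (1# + a) * (t · 1#)) (R.+-identityʳ 1#) ⟩
      (1# + 1#) * (t · 1#)         ≡⟨ cong (_* (t · 1#)) two≡0 ⟩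
      0# * (t · 1#)                ≡⟨ R.zeroˡ _ ⟩
      0#                           ∎

  Additive : ℕ → Set
  Additive m = ∀ x y → (x + y) ^ m ≡ x ^ m + y ^ m

  -- The Frobenius map: in characteristic p the inner binomial coefficients vanish.
  frobenius : ∀ {p} → Prime p → p · 1# ≡ 0# → Additive p
  frobenius {suc r} p-prime p·1≡0 x y = begin
    (x + y) ^ p                ≡⟨ ^≡Exp^ (x + y) p ⟩
    (x + y) Exp.^ p            ≡⟨ Binomial.theorem p x y ⟩
    ∑.sum T                    ≡⟨ cong₂ _+_ first (∑.sum-init-last (T ∘ Fin.suc)) ⟩
    y Exp.^ p + (∑.sum (T ∘ Fin.suc ∘ Fin.inject₁) + T (Fin.suc (Fin.fromℕ r)))
                               ≡⟨ cong (λ a → y Exp.^ p + (a + T (Fin.suc (Fin.fromℕ r)))) middle-vanish ⟩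
    y Exp.^ p + (0# + T (Fin.suc (Fin.fromℕ r)))
                               ≡⟨ cong (y Exp.^ p +_) (trans (R.+-identityˡ _) last) ⟩
    y Exp.^ p + x Exp.^ p      ≡⟨ R.+-comm _ _ ⟩
    x Exp.^ p + y Exp.^ p      ≡⟨ sym (cong₂ _+_ (^≡Exp^ x p) (^≡Exp^ y p)) ⟩
    x ^ p + y ^ p              ∎
    where
    p : ℕ
    p = suc r
    T : Fin (suc p) → Carrier
    T = Binomial.binomialTerm x y p

    p·z≡0 : ∀ z → p · z ≡ 0#
    p·z≡0 z = begin
      p · z          ≡⟨ cong (p ·_) (sym (R.*-identityˡ z)) ⟩
      p · (1# * z)   ≡⟨ sym (×-assoc-* p 1# z) ⟩
      (p · 1#) * z   ≡⟨ cong (_* z) p·1≡0 ⟩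
      0# * z         ≡⟨ R.zeroˡ z ⟩
      0#             ∎

    first : T Fin.zero ≡ y Exp.^ p
    first = trans (R.+-identityʳ _) (R.*-identityˡ _)

    middle : ∀ (i : Fin r) → T (Fin.suc (Fin.inject₁ i)) ≡ 0#
    middle i with prime∣binomial p-prime (s≤s z≤n) (s≤s (subst (_< r) (sym (FinP.toℕ-inject₁ i))
                                                                 (FinP.toℕ<n i)))
    ... | divides m C≡m*p = begin
      (p C k) · b       ≡⟨ cong (_· b) (trans C≡m*p (ℕP.*-comm m p)) ⟩
      (p ℕ.* m) · b     ≡⟨ sym (×-assocˡ b p m) ⟩
      p · (m · b)       ≡⟨ p·z≡0 (m · b) ⟩
      0#                ∎
      where
      k : ℕ
      k = suc (Fin.toℕ (Fin.inject₁ i))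
      b : Carrier
      b = Binomial.binomial x y p (Fin.suc (Fin.inject₁ i))

    middle-vanish : ∑.sum (T ∘ Fin.suc ∘ Fin.inject₁) ≡ 0#
    middle-vanish = trans (∑.sum-cong-≗ {r} middle) (∑.sum-replicate-zero r)

    last-term : ∀ k → Fin.toℕ k ≡ p → T k ≡ x Exp.^ p
    last-term k k≡p rewrite k≡p | nCn≡1 p | ℕP.n∸n≡0 p = trans (R.+-identityʳ _) (R.*-identityʳ _)

    last : T (Fin.suc (Fin.fromℕ r)) ≡ x Exp.^ p
    last = last-term (Fin.suc (Fin.fromℕ r)) (cong suc (FinP.toℕ-fromℕ r))

  frobenius-^ : ∀ {p} → Prime p → p · 1# ≡ 0# → ∀ k → Additive (p ℕ.^ k)
  frobenius-^ {p} p-prime p·1≡0 zero x y = R.distribʳ 1# x y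
  frobenius-^ {p} p-prime p·1≡0 (suc k) x y = begin
    (x + y) ^ (p ℕ.* p ℕ.^ k)                 ≡⟨ ^-* (x + y) p (p ℕ.^ k) ⟩
    ((x + y) ^ (p ℕ.^ k)) ^ p                 ≡⟨ cong (_^ p) (frobenius-^ p-prime p·1≡0 k x y) ⟩
    (x ^ (p ℕ.^ k) + y ^ (p ℕ.^ k)) ^ p       ≡⟨ frobenius p-prime p·1≡0 _ _ ⟩
    (x ^ (p ℕ.^ k)) ^ p + (y ^ (p ℕ.^ k)) ^ p ≡⟨ sym (cong₂ _+_ (^-* x p (p ℕ.^ k)) (^-* y p (p ℕ.^ k))) ⟩
    x ^ (p ℕ.* p ℕ.^ k) + y ^ (p ℕ.* p ℕ.^ k) ∎

  additive-neg : ∀ {m} → Additive m → 0 < m → ∀ x → (- x) ^ m ≡ - (x ^ m)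
  additive-neg {m} additive 0<m x = +-inverseʳ-unique (x ^ m) ((- x) ^ m) (begin
    x ^ m + (- x) ^ m   ≡⟨ sym (additive x (- x)) ⟩
    (x + - x) ^ m       ≡⟨ cong (_^ m) (R.-‿inverseʳ x) ⟩
    0# ^ m              ≡⟨ 0^ 0<m ⟩
    0#                  ∎)

  -- The sign of z records whether z precedes -z in the enumeration; in characteristic ≠ 2
  -- it tells the nonzero elements z and -z apart.
  sign : Carrier → Bool
  sign z = does (Fin.toℕ (to z) ℕP.<? Fin.toℕ (to (- z)))

  sign-neg : ¬ 1# + 1# ≡ 0# → ∀ {z} → ¬ z ≡ 0# → ¬ sign z ≡ sign (- z)
  sign-neg two≢0 {z} z≢0 same-sign =
    z≢0 (≡-⇒≡0 two≢0 (to-injective (FinP.toℕ-injective (<-symmetric⇒≡ (i ℕP.<? j) (j ℕP.<? i) same-order))))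
    where
    i j : ℕ
    i = Fin.toℕ (to z)
    j = Fin.toℕ (to (- z))
    -- sign (- z) compares j with the index of - - z = z
    same-order : does (i ℕP.<? j) ≡ does (j ℕP.<? i)
    same-order = trans same-sign (cong (λ w → does (j ℕP.<? Fin.toℕ (to w))) (-‿involutive z))

  +-transpose : ∀ x y x' y' → x + y ≡ x' + y' → x + - x' ≡ y' + - y
  +-transpose x y x' y' e = begin
    x + - x'                  ≡⟨ sym (R.+-identityʳ _) ⟩
    (x + - x') + 0#           ≡⟨ cong ((x + - x') +_) (sym (R.-‿inverseʳ y)) ⟩
    (x + - x') + (y + - y)    ≡⟨ solve 4 (λ x nx' y ny → (x :+ nx') :+ (y :+ ny) := (x :+ y) :+ (nx' :+ ny))
                                       refl x (- x') y (- y) ⟩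
    (x + y) + (- x' + - y)    ≡⟨ cong (_+ (- x' + - y)) e ⟩
    (x' + y') + (- x' + - y)  ≡⟨ solve 4 (λ x' y' nx' ny → (x' :+ y') :+ (nx' :+ ny) := (x' :+ nx') :+ (y' :+ ny))
                                       refl x' y' (- x') (- y) ⟩
    (x' + - x') + (y' + - y)  ≡⟨ cong (_+ (y' + - y)) (R.-‿inverseʳ x') ⟩
    0# + (y' + - y)           ≡⟨ R.+-identityˡ _ ⟩
    y' + - y                  ∎

  module Subfield (q : ℕ) (additive-q : Additive q) (0<q : 0 < q) where
    InFq : Carrier → Set
    InFq x = x ^ q ≡ x

    InFq? : Decidable InFq
    InFq? x = (x ^ q) ≟ x

    Fq-+ : ∀ {x y} → InFq x → InFq y → InFq (x + y)
    Fq-+ x∈ y∈ = trans (additive-q _ _) (cong₂ _+_ x∈ y∈)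

    Fq-* : ∀ {x y} → InFq x → InFq y → InFq (x * y)
    Fq-* x∈ y∈ = trans (*-^ _ _ q) (cong₂ _*_ x∈ y∈)

    Fq-- : ∀ {x} → InFq x → InFq (- x)
    Fq-- x∈ = trans (additive-neg additive-q 0<q _) (cong -_ x∈)

    Fq-^ : ∀ {x} m → InFq x → InFq (x ^ m)
    Fq-^ {x} m x∈ = begin
      (x ^ m) ^ q     ≡⟨ sym (^-* x q m) ⟩
      x ^ (q ℕ.* m)   ≡⟨ cong (x ^_) (ℕP.*-comm q m) ⟩
      x ^ (m ℕ.* q)   ≡⟨ ^-* x m q ⟩
      (x ^ q) ^ m     ≡⟨ cong (_^ m) x∈ ⟩
      x ^ m           ∎

    Fq-⁻¹ : ∀ {x x⁻¹} → InFq x → x * x⁻¹ ≡ 1# → InFq x⁻¹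
    Fq-⁻¹ {x} {x⁻¹} x∈ xx⁻¹≡1 = begin
      x⁻¹ ^ q                  ≡⟨ sym (inverse-cancel xx⁻¹≡1 _) ⟩
      x⁻¹ * (x * x⁻¹ ^ q)      ≡⟨ cong (λ a → x⁻¹ * (a * x⁻¹ ^ q)) (sym x∈) ⟩
      x⁻¹ * (x ^ q * x⁻¹ ^ q)  ≡⟨ cong (x⁻¹ *_) (sym (*-^ x x⁻¹ q)) ⟩
      x⁻¹ * (x * x⁻¹) ^ q      ≡⟨ cong (λ a → x⁻¹ * a ^ q) xx⁻¹≡1 ⟩
      x⁻¹ * 1# ^ q             ≡⟨ cong (x⁻¹ *_) (1^ q) ⟩
      x⁻¹ * 1#                 ≡⟨ R.*-identityʳ x⁻¹ ⟩
      x⁻¹                      ∎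

    module _ {μ : Carrier} (μ∉Fq : ¬ InFq μ) where
      solve-for-μ : ∀ {u w} → InFq u → InFq w → ¬ w ≡ 0# → u ≡ w * μ → InFq μ
      solve-for-μ {u} {w} u∈ w∈ w≢0 u≡wμ =
        subst InFq (trans (cong (w⁻¹ *_) u≡wμ) (inverse-cancel ww⁻¹≡1 μ)) (Fq-* (Fq-⁻¹ w∈ ww⁻¹≡1) u∈)
        where
        w⁻¹ : Carrier
        w⁻¹ = proj₁ (inverse w w≢0)
        ww⁻¹≡1 : w * w⁻¹ ≡ 1#
        ww⁻¹≡1 = proj₂ (inverse w w≢0)

      second-coordinate : ∀ {a b a' b'} → InFq a → InFq b → InFq a' → InFq b' →
                          a + b * μ ≡ a' + b' * μ → b ≡ b'
      second-coordinate {a} {b} {a'} {b'} a∈ b∈ a'∈ b'∈ e with (b' + - b) ≟ 0#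
      ... | yes b'-b≡0 = sym (x∙y⁻¹≈ε⇒x≈y b' b b'-b≡0)
      ... | no b'-b≢0 = contradiction (solve-for-μ (Fq-+ a∈ (Fq-- a'∈)) (Fq-+ b'∈ (Fq-- b∈)) b'-b≢0 (begin
        a + - a'                 ≡⟨ +-transpose a (b * μ) a' (b' * μ) e ⟩
        b' * μ + - (b * μ)       ≡⟨ cong (b' * μ +_) (-‿distribˡ-* b μ) ⟩
        b' * μ + - b * μ         ≡⟨ sym (R.distribʳ μ b' (- b)) ⟩
        (b' + - b) * μ           ∎)) μ∉Fq

      -- Counting: if N = q·q then F_q has at most q elements, because (a, b) ↦ a + bμ is an
      -- injective map F_q × F_q → F.  So the elements of F_q can be numbered injectively by Fin q.
      module Numbering (N≡q*q : N ≡ q ℕ.* q) where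
        open Ranking {P = InFq ∘ from} (InFq? ∘ from)

        element : Fin size → Carrier
        element = from ∘ member

        element-injective : ∀ k l → element k ≡ element l → k ≡ l
        element-injective k l e =
          member-injective k l (trans (sym (strictlyInverseˡ _)) (trans (cong to e) (strictlyInverseˡ _)))

        pairing : Fin (size ℕ.* size) → Fin N
        pairing k = to (element (proj₁ ij) + element (proj₂ ij) * μ)
          where
          ij : Fin size × Fin size
          ij = Fin.remQuot {size} size k

        pairing-injective : ∀ k l → pairing k ≡ pairing l → k ≡ l
        pairing-injective k l e = begin
          k                  ≡⟨ sym (FinP.combine-remQuot {size} size k) ⟩
          Fin.combine i j    ≡⟨ cong₂ Fin.combine (element-injective i i' same-a) (element-injective j j' same-b) ⟩
          Fin.combine i' j'  ≡⟨ FinP.combine-remQuot {size} size l ⟩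
          l                  ∎
          where
          i j i' j' : Fin size
          i = proj₁ (Fin.remQuot {size} size k)
          j = proj₂ (Fin.remQuot {size} size k)
          i' = proj₁ (Fin.remQuot {size} size l)
          j' = proj₂ (Fin.remQuot {size} size l)
          same-sum : element i + element j * μ ≡ element i' + element j' * μ
          same-sum = to-injective e
          same-b : element j ≡ element j'
          same-b = second-coordinate (member-∈ i) (member-∈ j) (member-∈ i') (member-∈ j') same-sum
          same-a : element i ≡ element i'
          same-a = +-cancelʳ (element j' * μ) _ _ (trans (cong (λ b → element i + b * μ) (sym same-b)) same-sum)

        size≤q : size ≤ q
        size≤q = ℕP.≮⇒≥ λ q<size → ℕP.<⇒≱ (ℕP.*-mono-< q<size q<size)
          (subst (size ℕ.* size ≤_) N≡q*q (FinP.injective⇒≤ {f = pairing} (pairing-injective _ _)))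

        number : ∀ z → InFq z → Fin q
        number z z∈ = Fin.inject≤ (rank (to z) (subst InFq (sym (strictlyInverseʳ z)) z∈)) size≤q

        number-injective : ∀ {z z'} (z∈ : InFq z) (z'∈ : InFq z') → number z z∈ ≡ number z' z'∈ → z ≡ z'
        number-injective z∈ z'∈ e = to-injective (rank-injective _ _ (FinP.inject≤-injective size≤q size≤q _ _ e))

  -- If x ↦ x^d is additive, N = d^(1+2k) and 2 ≠ 0, then x ↦ x^d + x is injective: the
  -- difference e of two preimages satisfies e^d = -e, hence e^(d·d) = e and, by Fermat,
  -- e = e^N = (e^((d·d)^k))^d = e^d = -e, so e = 0.
  ^+id-injective : ∀ {d k} → Additive d → 0 < d → N ≡ d ℕ.^ (1 ℕ.+ 2 ℕ.* k) → ¬ 1# + 1# ≡ 0# →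
                   ∀ a b → a ^ d + a ≡ b ^ d + b → a ≡ b
  ^+id-injective {d} {k} additive-d 0<d N≡d^[1+2k] two≢0 a b same =
    x∙y⁻¹≈ε⇒x≈y a b (≡-⇒≡0 two≢0 e≡-e)
    where
    e : Carrier
    e = a + - b

    e^d≡-e : e ^ d ≡ - e
    e^d≡-e = begin
      (a + - b) ^ d       ≡⟨ additive-d a (- b) ⟩
      a ^ d + (- b) ^ d   ≡⟨ cong (a ^ d +_) (additive-neg additive-d 0<d b) ⟩
      a ^ d + - (b ^ d)   ≡⟨ +-transpose (a ^ d) a (b ^ d) b same ⟩
      b + - a             ≡⟨ cong (_+ - a) (sym (-‿involutive b)) ⟩
      - - b + - a         ≡⟨ sym (-‿anti-homo-+ a (- b)) ⟩
      - (a + - b)         ∎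

    e^[d²]^j≡e : ∀ j → e ^ ((d ℕ.* d) ℕ.^ j) ≡ e
    e^[d²]^j≡e zero    = R.*-identityʳ e
    e^[d²]^j≡e (suc j) = begin
      e ^ ((d ℕ.* d) ℕ.* (d ℕ.* d) ℕ.^ j)   ≡⟨ ^-* e (d ℕ.* d) _ ⟩
      (e ^ ((d ℕ.* d) ℕ.^ j)) ^ (d ℕ.* d)   ≡⟨ cong (_^ (d ℕ.* d)) (e^[d²]^j≡e j) ⟩
      e ^ (d ℕ.* d)                         ≡⟨ ^-* e d d ⟩
      (e ^ d) ^ d                           ≡⟨ cong (_^ d) e^d≡-e ⟩
      (- e) ^ d                             ≡⟨ additive-neg additive-d 0<d e ⟩
      - (e ^ d)                             ≡⟨ cong -_ e^d≡-e ⟩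
      - - e                                 ≡⟨ -‿involutive e ⟩
      e                                     ∎

    N≡d*[d²]^k : N ≡ d ℕ.* (d ℕ.* d) ℕ.^ k
    N≡d*[d²]^k = trans N≡d^[1+2k] (cong (d ℕ.*_) (trans (sym (ℕP.^-*-assoc d 2 k))
                                                       (cong (ℕ._^ k) (cong (d ℕ.*_) (ℕP.*-identityʳ d)))))

    e≡-e : e ≡ - e
    e≡-e = begin
      e                                   ≡⟨ sym (fermat e) ⟩
      e ^ N                               ≡⟨ cong (e ^_) N≡d*[d²]^k ⟩
      e ^ (d ℕ.* (d ℕ.* d) ℕ.^ k)         ≡⟨ ^-* e d _ ⟩
      (e ^ ((d ℕ.* d) ℕ.^ k)) ^ d         ≡⟨ cong (_^ d) (e^[d²]^j≡e k) ⟩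
      e ^ d                               ≡⟨ e^d≡-e ⟩
      - e                                 ∎

  -- The translations φ_b are automorphisms of A_{q²,d}: if φ_b(a^d+a, x) and φ_b(a'^d+a', x')
  -- are adjacent, then so are (a^d+a, x) and (a'^d+a', x'), i.e. a^d a' + a a'^d = x + x'.
  module Translation (q d : ℕ) (additive-d : Additive d)
                     (^+id-inj : ∀ a b → a ^ d + a ≡ b ^ d + b → a ≡ b) where
    open Construction F q d using (Adj; φ)

    φ-reflects-adjacency : ∀ b a x a' x' → Adj (φ b a x) (φ b a' x') → (a ^ d) * a' + a * (a' ^ d) ≡ x + x'
    φ-reflects-adjacency b a x a' x' (_ , A , B , u≡A^d+A , v≡B^d+B , edge) = +-cancelʳ Z _ _ (begin
      ((a ^ d) * a' + a * (a' ^ d)) + Z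
        ≡⟨ solve 6 (λ ad a a' a'd b D →
                      (ad :* a' :+ a :* a'd) :+ (ad :* b :+ D :* a' :+ D :* b :+ a :* D :+ b :* a'd :+ b :* D)
                      := (ad :+ D) :* (a' :+ b) :+ (a :+ b) :* (a'd :+ D))
                   refl (a ^ d) a a' (a' ^ d) b D ⟩
      (a ^ d + D) * (a' + b) + (a + b) * (a' ^ d + D)
        ≡⟨ cong₂ (λ X Y → X * (a' + b) + (a + b) * Y) (sym (additive-d a b)) (sym (additive-d a' b)) ⟩
      ((a + b) ^ d) * (a' + b) + (a + b) * ((a' + b) ^ d)
        ≡⟨ subst₂ (λ A B → (A ^ d) * B + A * (B ^ d) ≡ _) (A≡a+b a u≡A^d+A) (A≡a+b a' v≡B^d+B) edge ⟩
      x + (a ^ d) * b + a * D + b * D + (x' + (a' ^ d) * b + a' * D + b * D)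
        ≡⟨ solve 8 (λ x x' ad a a'd a' b D →
                      x :+ ad :* b :+ a :* D :+ b :* D :+ (x' :+ a'd :* b :+ a' :* D :+ b :* D)
                      := (x :+ x') :+ (ad :* b :+ D :* a' :+ D :* b :+ a :* D :+ b :* a'd :+ b :* D))
                   refl x x' (a ^ d) a (a' ^ d) a' b D ⟩
      (x + x') + Z
        ∎)
      where
      D Z : Carrier
      D = b ^ d
      Z = (a ^ d) * b + D * a' + D * b + a * D + b * (a' ^ d) + b * D

      -- the first coordinate of φ_b(c^d+c, _) is (c+b)^d + (c+b), so it determines c + b
      A≡a+b : ∀ {A} c → c ^ d + c + (b ^ d + b) ≡ A ^ d + A → A ≡ c + b
      A≡a+b {A} c e = ^+id-inj A (c + b) (begin
        A ^ d + A                 ≡⟨ sym e ⟩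
        c ^ d + c + (b ^ d + b)   ≡⟨ solve 4 (λ cd c bd b → cd :+ c :+ (bd :+ b) := (cd :+ bd) :+ (c :+ b))
                                           refl (c ^ d) c (b ^ d) b ⟩
        (c ^ d + b ^ d) + (c + b) ≡⟨ cong (_+ (c + b)) (sym (additive-d c b)) ⟩
        (c + b) ^ d + (c + b)     ∎)

  module KColouring (q d : ℕ) (additive-q : Additive q) (0<q : 0 < q) (N≡q*q : N ≡ q ℕ.* q)
                    (additive-d : Additive d) (^+id-inj : ∀ a b → a ^ d + a ≡ b ^ d + b → a ≡ b)
                    (2≢0 : ¬ 1# + 1# ≡ 0#) (μ : Carrier) (μ∉Fq : ¬ μ ^ q ≡ μ) where
    open Construction F q d using (Vertex; Adj; φ; InK; ChromaticAtMost)
    open Subfield q additive-q 0<q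
    open Numbering μ∉Fq N≡q*q using (number; number-injective)
    open Translation q d additive-d ^+id-inj

    -- Adjacent vertices of K with the same β have opposite x₂: the left side a^d a' + a a'^d
    -- lies in F_q, so the μ-coordinate x₂ + x₂' of the right side vanishes.
    opposite : ∀ {b a x₁ x₂ a' x₁' x₂'} → InFq a → InFq x₁ → InFq x₂ → InFq a' → InFq x₁' → InFq x₂' →
               Adj (φ b a (x₁ + x₂ * μ)) (φ b a' (x₁' + x₂' * μ)) → x₂' ≡ - x₂
    opposite {b} {a} {x₁} {x₂} {a'} {x₁'} {x₂'} a∈ x₁∈ x₂∈ a'∈ x₁'∈ x₂'∈ adj =
      +-inverseʳ-unique x₂ x₂' (sym (second-coordinate μ∉Fq L∈ (0^ 0<q) (Fq-+ x₁∈ x₁'∈) (Fq-+ x₂∈ x₂'∈) (begin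
        L + 0# * μ                                ≡⟨ cong (L +_) (R.zeroˡ μ) ⟩
        L + 0#                                    ≡⟨ R.+-identityʳ L ⟩
        L                                         ≡⟨ φ-reflects-adjacency b a _ a' _ adj ⟩
        (x₁ + x₂ * μ) + (x₁' + x₂' * μ)           ≡⟨ solve 5 (λ x₁ x₂ x₁' x₂' μ →
                                                        (x₁ :+ x₂ :* μ) :+ (x₁' :+ x₂' :* μ)
                                                        := (x₁ :+ x₁') :+ (x₂ :+ x₂') :* μ)
                                                     refl x₁ x₂ x₁' x₂' μ ⟩
        (x₁ + x₁') + (x₂ + x₂') * μ               ∎)))
      where
      L : Carrier
      L = (a ^ d) * a' + a * (a' ^ d)
      L∈ : InFq L
      L∈ = Fq-+ (Fq-* (Fq-^ d a∈) a'∈) (Fq-* a∈ (Fq-^ d a'∈))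

    InK? : Decidable (InK μ)
    InK? w = ∃? λ β → ∃? λ a → ∃? λ x₁ → ∃? λ x₂ →
      InFq? β ×-dec InFq? a ×-dec InFq? x₁ ×-dec InFq? x₂ ×-dec ¬? (x₂ ≟ 0#) ×-dec
      ×P.≡-dec _≟_ _≟_ w (φ (β * μ) a (x₁ + x₂ * μ))

    colourOf : ∀ w → InK μ w → Fin (2 ℕ.* q)
    colourOf w (β , a , x₁ , x₂ , β∈ , _) = Fin.combine (bit (sign x₂)) (number β β∈)

    colourOf-proper : ∀ v w (v∈K : InK μ v) (w∈K : InK μ w) → Adj v w → ¬ colourOf v v∈K ≡ colourOf w w∈K
    colourOf-proper _ _ (β , a , x₁ , x₂ , β∈ , a∈ , x₁∈ , x₂∈ , x₂≢0 , refl)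
                        (β' , a' , x₁' , x₂' , β'∈ , a'∈ , x₁'∈ , x₂'∈ , _ , refl) adj same-colour
      with FinP.combine-injective (bit (sign x₂)) (number β β∈) (bit (sign x₂')) (number β' β'∈) same-colour
    ... | same-bit , same-number with number-injective β∈ β'∈ same-number
    ... | refl = sign-neg 2≢0 x₂≢0 (trans (bit-injective _ _ same-bit)
                                          (cong sign (opposite a∈ x₁∈ x₂∈ a'∈ x₁'∈ x₂'∈ adj)))

    colour : Vertex → Fin (2 ℕ.* q)
    colour w with InK? w
    ... | yes w∈K = colourOf w w∈K
    ... | no _    = Fin.fromℕ< (ℕP.<-≤-trans 0<q (ℕP.m≤m+n q _))

    colouring : ChromaticAtMost μ (2 ℕ.* q)
    colouring = colour , proper
      where
      proper : ∀ v w → InK μ v → InK μ w → Adj v w → ¬ colour v ≡ colour w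
      proper v w v∈K w∈K adj with InK? v | InK? w
      ... | yes v∈K′ | yes w∈K′ = colourOf-proper v w v∈K′ w∈K′ adj
      ... | no v∉K   | _        = contradiction v∈K v∉K
      ... | yes _    | no w∉K   = contradiction w∈K w∉K

-- The arithmetic notation of the statement; it is brought into scope only here because above
-- _+_, _*_ and _^_ denote the field operations.
open import Data.Nat using (_+_; _*_; _^_; _∸_; _≥_)

mainTheorem11 : (p n s : ℕ) → Prime p → (∃ λ t → p ≡ 1 + 2 * t) → n ≥ 1 → s ≥ 1 →
    (∃ λ k → k ≥ 1 × 2 * n ≡ (1 + 2 * k) * s) →
    (F : FiniteField (p ^ (2 * n))) →
    (μ u₁ u₂ : FiniteField.Carrier F) →
    ¬ Construction.InFq F (p ^ n) (p ^ s) μ →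
    Construction.InFq F (p ^ n) (p ^ s) u₁ →
    Construction.InFq F (p ^ n) (p ^ s) u₂ →
    FiniteField._^_ F μ (p ^ s) ≡ FiniteField._+_ F u₁ (FiniteField._*_ F u₂ μ) →
    (∃ λ w → FiniteField._^_ F w (p ^ s ∸ 1) ≡ u₂) →
    Construction.ChromaticAtMost F (p ^ n) (p ^ s) μ (2 * p ^ n)
mainTheorem11 p n s p-prime (t , p≡1+2t) _ _ (k , _ , 2n≡[1+2k]s) F μ _ _ μ∉Fq _ _ _ _ =
  KColouring.colouring (p ^ n) (p ^ s) (frobenius-^ p-prime p·1≡0 n) (0<p^ n) N≡q*q
    additive-d (^+id-injective {k = k} additive-d (0<p^ s) N≡d^[1+2k] 2≢0) 2≢0 μ μ∉Fq
  where
  open FiniteField F using (0#; 1#) renaming (_+_ to _+F_)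
  open FiniteFieldTheory F

  0<p^ : ∀ e → 0 ℕ.< p ^ e
  0<p^ = ℕP.m^n>0 p {{prime⇒nonZero p-prime}}

  N≡q*q : p ^ (2 * n) ≡ p ^ n * p ^ n
  N≡q*q = trans (cong (p ^_) (cong (n +_) (ℕP.+-identityʳ n))) (ℕP.^-distribˡ-+-* p n n)

  N≡d^[1+2k] : p ^ (2 * n) ≡ (p ^ s) ^ (1 + 2 * k)
  N≡d^[1+2k] = trans (cong (p ^_) (trans 2n≡[1+2k]s (ℕP.*-comm (1 + 2 * k) s)))
                     (sym (ℕP.^-*-assoc p s (1 + 2 * k)))

  p·1≡0 : p · 1# ≡ 0#
  p·1≡0 = characteristic p (2 * n) refl

  2≢0 : ¬ 1# +F 1# ≡ 0#
  2≢0 = two≢0 {t = t} p·1≡0 p≡1+2t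

  additive-d : Additive (p ^ s)
  additive-d = frobenius-^ p-prime p·1≡0 s
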